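{- For every positive integer $r$ there exists a $2$-coverable connected binary matroid $M$ of rank $r$ such that in every rainbow circuit-free coloring of $M$ in which each color is used at most three times, the number of colors is at most $\lceil 6r/7\rceil$.
   Context: A matroid is binary if it is representable over $GF(2)$; it is connected if any two elements lie in a common circuit; it is $2$-coverable if its ground set is the union of at most two independent sets. A coloring of the ground set is a partition into nonempty color classes; it is rainbow circuit-free if every circuit contains two elements of the same color. -}

module Defs where

open import Data.Bool using (Bool; true; false; if_then_else_; _xor_)
open import Data.Nat using (ℕ; zero; suc; _+_; _*_; _/_; _≤_)
open import Data.Fin using (Fin; zero; suc; _≟_)
open import Data.Fin.Subset using (Subset; _∈_; _⊆_; _⊂_; _∪_; ⊤; ∣_∣; Nonempty)
open import Data.Vec using (Vec; []; _∷_; replicate; zipWith; tabulate)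
open import Data.Product using (Σ; ∃; ∃-syntax; _×_)
open import Relation.Binary.PropositionalEquality using (_≡_; _≢_)
open import Relation.Nullary using (¬_)
open import Relation.Nullary.Decidable using (⌊_⌋)

-- A binary matroid given by a GF(2)-representation: the ground set is Fin n,
-- element e is represented by the column vector vec e ∈ GF(2)^m (Bool, xor = +).
record BinaryMatroid : Set where
  field
    n   : ℕ
    m   : ℕ
    vec : Fin n → Vec Bool m

open BinaryMatroid public

sumSub : ∀ {n m} → (Fin n → Vec Bool m) → Subset n → Vec Bool m
sumSub {m = m} v []      = replicate m false
sumSub v (true  ∷ s) = zipWith _xor_ (v zero) (sumSub (λ i → v (suc i)) s)
sumSub v (false ∷ s) = sumSub (λ i → v (suc i)) s

module _ (M : BinaryMatroid) where

  -- S is dependent iff the vectors of S are linearly dependent over GF(2),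
  -- i.e. some nonempty subset of S has zero sum.
  Dependent : Subset (n M) → Set
  Dependent S = ∃[ T ] (T ⊆ S × Nonempty T × sumSub (vec M) T ≡ replicate (m M) false)

  Independent : Subset (n M) → Set
  Independent S = ¬ Dependent S

  Circuit : Subset (n M) → Set
  Circuit C = Dependent C × (∀ D → D ⊂ C → Independent D)

  HasRank : ℕ → Set
  HasRank r = (∃[ B ] (Independent B × ∣ B ∣ ≡ r)) × (∀ I → Independent I → ∣ I ∣ ≤ r)

  Connected : Set
  Connected = ∀ (x y : Fin (n M)) → x ≢ y → ∃[ C ] (Circuit C × x ∈ C × y ∈ C)

  TwoCoverable : Set
  TwoCoverable = ∃[ I ] ∃[ J ] (Independent I × Independent J × I ∪ J ≡ ⊤)

  IsColoring : ∀ {k} → (Fin (n M) → Fin k) → Set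
  IsColoring {k} c = ∀ (j : Fin k) → ∃[ e ] (c e ≡ j)

  RainbowCircuitFree : ∀ {k} → (Fin (n M) → Fin k) → Set
  RainbowCircuitFree c =
    ∀ C → Circuit C → ∃[ x ] ∃[ y ] (x ≢ y × x ∈ C × y ∈ C × c x ≡ c y)

colorClass : ∀ {n k} → (Fin n → Fin k) → Fin k → Subset n
colorClass c j = tabulate (λ e → ⌊ c e ≟ j ⌋)

ceil6r/7 : ℕ → ℕ
ceil6r/7 r = (6 * r + 6) / 7

module Submission where

-- The witness extends the direct sum of a = ⌊r/7⌋ copies of AG(3,2) and b + 1 coloops
-- (rank r = 4a + b + 1) by one element whose vector is the sum of one point of each copy
-- and of all coloops.  That element, those points and the coloops form a circuit, and
-- replacing a point by a line of its copy missing it gives further circuits; together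
-- with the planes of a copy (its 4-circuits) they make the matroid connected.
-- In a rainbow-circuit-free colouring with classes of size at most 3 a copy of AG(3,2)
-- shows at most three colours: four differently coloured points span it, each remaining
-- point lies on a plane with three of them and so repeats one of their colours, and the
-- planes through two of the four points and two remaining points force a colour to be
-- used four times.  The big circuit repeats a colour as well, so at most
-- (a + b + 1) + 2a = r − a ≤ ⌈6r/7⌉ colours occur.

open import Defs
open import Data.Bool using (Bool; true; false; _xor_; if_then_else_)
open import Data.Bool.Properties
  using (xor-assoc; xor-comm; xor-identityˡ; xor-identityʳ; xor-same; ¬-not) renaming (_≟_ to _≟ᵇ_)
open import Data.Nat using (ℕ; zero; suc; _+_; _*_; _∸_; _≤_; _<_; _/_; z≤n; s≤s)
open import Data.Nat.Properties
  using ( ≤-refl; ≤-trans; ≤-reflexive; m≤n⇒m≤1+n; ≤-pred; +-mono-≤; +-monoʳ-≤; *-monoʳ-≤; +-suc; m+[n∸m]≡n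
        ; +-cancelʳ-≤; module ≤-Reasoning)
open import Data.Nat.DivMod using (m/n*n≤m; m≡m%n+[m/n]*n; m%n<n; m*n/n≡m; /-monoˡ-≤)
open import Data.Nat.Tactic.RingSolver using (solve-∀)
open import Data.Fin using (Fin; zero; suc; #_; _≟_; _↑ˡ_; _↑ʳ_)
open import Data.Fin.Properties
  using (all?; any?; ¬∀⟶∃¬; injective⇒≤; ↑ˡ-injective; ↑ʳ-injective; suc-injective)
open import Data.Fin.Subset using (Subset; _∈_; _∉_; _⊆_; _⊂_; _-_; ⁅_⁆; _∪_; ⊥; ⊤; ∁; ∣_∣; Nonempty)
open import Data.Fin.Subset.Properties
  using ( drop-there; ∉⊥; ∈⊤; ⊆⊤; x∈⁅x⁆; x∈⁅y⁆⇒x≡y; ⊆-antisym; x∈p∧x≢y⇒x∈p-y; x∈p⇒p-x⊂p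
        ; x∈p⇒∣p-x∣<∣p∣; x∈p∪q⁺; x∈p∪q⁻; p⊆p∪q; q⊆p∪q; x∉p⇒x∈∁p; ∣⊥∣≡0; ∣⊤∣≡n; Empty-unique
        ; _∈?_; _⊆?_; nonempty?; anySubset?)
open import Data.Vec
  using (Vec; []; _∷_; replicate; zipWith; lookup; head; tail; _++_; splitAt; map; tabulate; removeAt; allFin; here; there)
open import Data.Vec.Properties
  using ( zipWith-assoc; zipWith-comm; zipWith-identityˡ; zipWith-identityʳ; zipWith-++; lookup-zipWith
        ; lookup-replicate; lookup-++ˡ; lookup-++ʳ; ++-injective; lookup-map; lookup∘tabulate; tabulate∘lookup
        ; []=⇒lookup; lookup⇒[]=; ≡-dec)
import Data.Vec.Functional as Fun
import Data.Vec.Functional.Properties as Funₚ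
open import Data.Vec.Relation.Unary.All using (All; []; _∷_)
open import Data.Vec.Relation.Unary.AllPairs using ([]; _∷_; allPairs?)
import Data.Vec.Relation.Unary.Any as Any
import Data.Vec.Relation.Unary.Any.Properties as Anyₚ
open import Data.Vec.Relation.Unary.Unique.Propositional using (Unique)
open import Data.Vec.Relation.Unary.Unique.Propositional.Properties as Uniqueₚ using (lookup-injective; tabulate⁺)
open import Data.Vec.Membership.Propositional using () renaming (_∈_ to _∈ᵥ_; _∉_ to _∉ᵥ_)
open import Data.List as List using (List; length; filter)
open import Data.List.Properties using (length-++; length-tabulate; filter-notAll)
import Data.List.Relation.Unary.Any as ListAny
import Data.List.Relation.Unary.Any.Properties as ListAnyₚ
import Data.List.Membership.Propositional as Listₘ
import Data.List.Membership.Propositional.Properties as Listₚ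
open import Data.Product using (_×_; _,_; ∃-syntax; proj₁; proj₂)
open import Data.Sum using (_⊎_; inj₁; inj₂)
import Data.Empty as Empty
open import Relation.Binary.PropositionalEquality
open import Relation.Nullary using (¬_; Dec; yes; no; ¬?; contradiction)
open import Relation.Nullary.Decidable
  using (_×-dec_; _→-dec_; map′; toWitness; ⌊_⌋; dec-true; isYes≗does; decidable-stable)
open import Function using (_∘_; id; const)

-- Vectors over GF(2) and sums of subsets

infixl 6 _+ᵥ_

_+ᵥ_ : ∀ {m} → Vec Bool m → Vec Bool m → Vec Bool m
_+ᵥ_ = zipWith _xor_

0ᵥ : ∀ {m} → Vec Bool m
0ᵥ = replicate _ false

+ᵥ-self : ∀ {m} (x : Vec Bool m) → x +ᵥ x ≡ 0ᵥ
+ᵥ-self []      = refl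
+ᵥ-self (b ∷ x) = cong₂ _∷_ (xor-same b) (+ᵥ-self x)

module _ {m : ℕ} where

  +ᵥ-assoc : (x y z : Vec Bool m) → (x +ᵥ y) +ᵥ z ≡ x +ᵥ (y +ᵥ z)
  +ᵥ-assoc = zipWith-assoc xor-assoc

  +ᵥ-comm : (x y : Vec Bool m) → x +ᵥ y ≡ y +ᵥ x
  +ᵥ-comm = zipWith-comm xor-comm

  +ᵥ-identityˡ : (x : Vec Bool m) → 0ᵥ +ᵥ x ≡ x
  +ᵥ-identityˡ = zipWith-identityˡ xor-identityˡ

  +ᵥ-identityʳ : (x : Vec Bool m) → x +ᵥ 0ᵥ ≡ x
  +ᵥ-identityʳ = zipWith-identityʳ xor-identityʳ

  +ᵥ-middle : (x y z u : Vec Bool m) → (x +ᵥ y) +ᵥ (z +ᵥ u) ≡ (x +ᵥ z) +ᵥ (y +ᵥ u)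
  +ᵥ-middle x y z u = begin
    (x +ᵥ y) +ᵥ (z +ᵥ u)  ≡⟨ +ᵥ-assoc x y (z +ᵥ u) ⟩
    x +ᵥ (y +ᵥ (z +ᵥ u))  ≡⟨ cong (x +ᵥ_) (sym (+ᵥ-assoc y z u)) ⟩
    x +ᵥ ((y +ᵥ z) +ᵥ u)  ≡⟨ cong (λ t → x +ᵥ (t +ᵥ u)) (+ᵥ-comm y z) ⟩
    x +ᵥ ((z +ᵥ y) +ᵥ u)  ≡⟨ cong (x +ᵥ_) (+ᵥ-assoc z y u) ⟩
    x +ᵥ (z +ᵥ (y +ᵥ u))  ≡⟨ sym (+ᵥ-assoc x z (y +ᵥ u)) ⟩
    (x +ᵥ z) +ᵥ (y +ᵥ u)  ∎
    where open ≡-Reasoning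

  +ᵥ-cancel : {x y : Vec Bool m} → x +ᵥ y ≡ 0ᵥ → x ≡ y
  +ᵥ-cancel {x} {y} x+y≡0 = begin
    x              ≡⟨ sym (+ᵥ-identityʳ x) ⟩
    x +ᵥ 0ᵥ        ≡⟨ cong (x +ᵥ_) (sym (+ᵥ-self y)) ⟩
    x +ᵥ (y +ᵥ y)  ≡⟨ sym (+ᵥ-assoc x y y) ⟩
    (x +ᵥ y) +ᵥ y  ≡⟨ cong (_+ᵥ y) x+y≡0 ⟩
    0ᵥ +ᵥ y        ≡⟨ +ᵥ-identityˡ y ⟩
    y              ∎
    where open ≡-Reasoning

Additive : ∀ {m m′} → (Vec Bool m → Vec Bool m′) → Set
Additive f = f 0ᵥ ≡ 0ᵥ × (∀ x y → f (x +ᵥ y) ≡ f x +ᵥ f y)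

sumSub-cong : ∀ {n m} {v w : Fin n → Vec Bool m} → (∀ e → v e ≡ w e) → ∀ T → sumSub v T ≡ sumSub w T
sumSub-cong v≗w []          = refl
sumSub-cong v≗w (true ∷ T)  = cong₂ _+ᵥ_ (v≗w zero) (sumSub-cong (v≗w ∘ suc) T)
sumSub-cong v≗w (false ∷ T) = sumSub-cong (v≗w ∘ suc) T

sumSub-additive : ∀ {n m m′} {f : Vec Bool m → Vec Bool m′} → Additive f →
                  ∀ (v : Fin n → Vec Bool m) T → sumSub (f ∘ v) T ≡ f (sumSub v T)
sumSub-additive (f0 , f+) v []          = sym f0
sumSub-additive (f0 , f+) v (true ∷ T)  =
  trans (cong (_ +ᵥ_) (sumSub-additive (f0 , f+) (v ∘ suc) T)) (sym (f+ _ _))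
sumSub-additive (f0 , f+) v (false ∷ T) = sumSub-additive (f0 , f+) (v ∘ suc) T

sumSub-closed : ∀ {n m} (P : Vec Bool m → Set) → P 0ᵥ → (∀ {x y} → P x → P y → P (x +ᵥ y)) →
                ∀ {v : Fin n → Vec Bool m} {T} → (∀ {e} → e ∈ T → P (v e)) → P (sumSub v T)
sumSub-closed P P0 P+ {T = []}        _   = P0
sumSub-closed P P0 P+ {T = true ∷ T}  P∈T = P+ (P∈T here) (sumSub-closed P P0 P+ (P∈T ∘ there))
sumSub-closed P P0 P+ {T = false ∷ T} P∈T = sumSub-closed P P0 P+ (P∈T ∘ there)

sumSub-⊥ : ∀ {n m} (v : Fin n → Vec Bool m) → sumSub v ⊥ ≡ 0ᵥ
sumSub-⊥ v = sumSub-closed (_≡ 0ᵥ) refl (λ x≡0 y≡0 → trans (cong₂ _+ᵥ_ x≡0 y≡0) (+ᵥ-identityˡ 0ᵥ))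
               {v = v} {T = ⊥} λ e∈⊥ → contradiction e∈⊥ ∉⊥

sumSub-⁅⁆ : ∀ {n m} (v : Fin n → Vec Bool m) e → sumSub v ⁅ e ⁆ ≡ v e
sumSub-⁅⁆ v zero    = trans (cong (v zero +ᵥ_) (sumSub-⊥ (v ∘ suc))) (+ᵥ-identityʳ (v zero))
sumSub-⁅⁆ v (suc e) = sumSub-⁅⁆ (v ∘ suc) e

infixr 7 _△_

_△_ : ∀ {n} → Subset n → Subset n → Subset n
_△_ = zipWith _xor_

∈-△⁻ : ∀ {n} (p q : Subset n) {x} → x ∈ p △ q → x ∈ p × x ∉ q ⊎ x ∉ p × x ∈ q
∈-△⁻ (true  ∷ p) (false ∷ q) here = inj₁ (here , λ ())
∈-△⁻ (false ∷ p) (true  ∷ q) here = inj₂ ((λ ()) , here)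
∈-△⁻ (_ ∷ p) (_ ∷ q) (there x∈p△q) with ∈-△⁻ p q x∈p△q
... | inj₁ (x∈p , x∉q) = inj₁ (there x∈p , x∉q ∘ drop-there)
... | inj₂ (x∉p , x∈q) = inj₂ (x∉p ∘ drop-there , there x∈q)

∈-△⁺ˡ : ∀ {n} {p q : Subset n} {x} → x ∈ p → x ∉ q → x ∈ p △ q
∈-△⁺ˡ {q = true  ∷ q} here        x∉q = contradiction here x∉q
∈-△⁺ˡ {q = false ∷ q} here        x∉q = here
∈-△⁺ˡ {q = _ ∷ q}     (there x∈p) x∉q = there (∈-△⁺ˡ x∈p (x∉q ∘ there))

∈-△⁺ʳ : ∀ {n} {p q : Subset n} {x} → x ∉ p → x ∈ q → x ∈ p △ q
∈-△⁺ʳ {p = true  ∷ p} x∉p here        = contradiction here x∉p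
∈-△⁺ʳ {p = false ∷ p} x∉p here        = here
∈-△⁺ʳ {p = _ ∷ p}     x∉p (there x∈q) = there (∈-△⁺ʳ (x∉p ∘ there) x∈q)

sumSub-△ : ∀ {n m} (v : Fin n → Vec Bool m) S T → sumSub v (S △ T) ≡ sumSub v S +ᵥ sumSub v T
sumSub-△ v []          []          = sym (+ᵥ-identityˡ 0ᵥ)
sumSub-△ v (true ∷ S)  (true ∷ T)  = begin
  sumSub (v ∘ suc) (S △ T)          ≡⟨ sumSub-△ (v ∘ suc) S T ⟩
  ΣS +ᵥ ΣT                          ≡⟨ sym (+ᵥ-identityˡ _) ⟩
  0ᵥ +ᵥ (ΣS +ᵥ ΣT)                  ≡⟨ cong (_+ᵥ (ΣS +ᵥ ΣT)) (sym (+ᵥ-self (v zero))) ⟩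
  (v zero +ᵥ v zero) +ᵥ (ΣS +ᵥ ΣT)  ≡⟨ +ᵥ-middle (v zero) (v zero) ΣS ΣT ⟩
  (v zero +ᵥ ΣS) +ᵥ (v zero +ᵥ ΣT)  ∎
  where open ≡-Reasoning; ΣS = sumSub (v ∘ suc) S; ΣT = sumSub (v ∘ suc) T
sumSub-△ v (true ∷ S)  (false ∷ T) =
  trans (cong (v zero +ᵥ_) (sumSub-△ (v ∘ suc) S T)) (sym (+ᵥ-assoc (v zero) _ _))
sumSub-△ v (false ∷ S) (true ∷ T)  = begin
  v zero +ᵥ sumSub (v ∘ suc) (S △ T)  ≡⟨ cong (v zero +ᵥ_) (sumSub-△ (v ∘ suc) S T) ⟩
  v zero +ᵥ (ΣS +ᵥ ΣT)                ≡⟨ sym (+ᵥ-assoc (v zero) ΣS ΣT) ⟩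
  (v zero +ᵥ ΣS) +ᵥ ΣT                ≡⟨ cong (_+ᵥ ΣT) (+ᵥ-comm (v zero) ΣS) ⟩
  (ΣS +ᵥ v zero) +ᵥ ΣT                ≡⟨ +ᵥ-assoc ΣS (v zero) ΣT ⟩
  ΣS +ᵥ (v zero +ᵥ ΣT)                ∎
  where open ≡-Reasoning; ΣS = sumSub (v ∘ suc) S; ΣT = sumSub (v ∘ suc) T
sumSub-△ v (false ∷ S) (false ∷ T) = sumSub-△ (v ∘ suc) S T

∣p∣≤1+∣p△⁅x⁆∣ : ∀ {n} (p : Subset n) x → ∣ p ∣ ≤ suc ∣ p △ ⁅ x ⁆ ∣
∣p∣≤1+∣p△⁅x⁆∣ (true  ∷ p) zero    =
  ≤-reflexive (cong (suc ∘ ∣_∣) (sym (zipWith-identityʳ xor-identityʳ p)))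
∣p∣≤1+∣p△⁅x⁆∣ (false ∷ p) zero    =
  m≤n⇒m≤1+n (m≤n⇒m≤1+n (≤-reflexive (cong ∣_∣ (sym (zipWith-identityʳ xor-identityʳ p)))))
∣p∣≤1+∣p△⁅x⁆∣ (true  ∷ p) (suc x) = s≤s (∣p∣≤1+∣p△⁅x⁆∣ p x)
∣p∣≤1+∣p△⁅x⁆∣ (false ∷ p) (suc x) = ∣p∣≤1+∣p△⁅x⁆∣ p x

-- Independence and circuits

module _ (M : BinaryMatroid) where

  independent-⊥ : Independent M ⊥
  independent-⊥ (T , T⊆⊥ , (x , x∈T) , _) = ∉⊥ (T⊆⊥ x∈T)

  dependent? : ∀ S → Dec (Dependent M S)
  dependent? S = anySubset? λ T → T ⊆? S ×-dec nonempty? T ×-dec ≡-dec _≟ᵇ_ (sumSub (vec M) T) 0ᵥ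

  independent? : ∀ S → Dec (Independent M S)
  independent? S = ¬? (dependent? S)

  -- A dependent T inside a proper subset of C either misses e, and then lies in I, or
  -- contains e, and then C △ T is a nonempty zero-sum subset of I.
  circuit-intro : ∀ {C I e} → Independent M I → e ∈ C → (∀ {x} → x ∈ C → x ≢ e → x ∈ I) →
                  sumSub (vec M) C ≡ 0ᵥ → Circuit M C
  circuit-intro {C} {I} {e} indep-I e∈C C-e⊆I ΣC≡0 = (C , id , (e , e∈C) , ΣC≡0) , minimal
    where
    minimal : ∀ D → D ⊂ C → Independent M D
    minimal D (D⊆C , x , x∈C , x∉D) (T , T⊆D , (t , t∈T) , ΣT≡0) with e ∈? T
    ... | no e∉T = indep-I (T , T⊆I , (t , t∈T) , ΣT≡0)
      where
      T⊆I : T ⊆ I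
      T⊆I y∈T = C-e⊆I (D⊆C (T⊆D y∈T)) λ { refl → e∉T y∈T }
    ... | yes e∈T = indep-I (C △ T , C△T⊆I , (x , ∈-△⁺ˡ x∈C (x∉D ∘ T⊆D)) , ΣC△T≡0)
      where
      C△T⊆I : C △ T ⊆ I
      C△T⊆I y∈C△T with ∈-△⁻ C T y∈C△T
      ... | inj₁ (y∈C , y∉T) = C-e⊆I y∈C λ { refl → y∉T e∈T }
      ... | inj₂ (y∉C , y∈T) = contradiction (D⊆C (T⊆D y∈T)) y∉C
      ΣC△T≡0 : sumSub (vec M) (C △ T) ≡ 0ᵥ
      ΣC△T≡0 = trans (sumSub-△ (vec M) C T) (trans (cong₂ _+ᵥ_ ΣC≡0 ΣT≡0) (+ᵥ-identityˡ 0ᵥ))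

  circuit-sum≡0 : ∀ {C} → Circuit M C → sumSub (vec M) C ≡ 0ᵥ
  circuit-sum≡0 {C} ((T , T⊆C , T≢∅ , ΣT≡0) , minimal) =
    subst (λ X → sumSub (vec M) X ≡ 0ᵥ) (⊆-antisym T⊆C C⊆T) ΣT≡0
    where
    C⊆T : C ⊆ T
    C⊆T {x} x∈C with x ∈? T
    ... | yes x∈T = x∈T
    ... | no  x∉T = Empty.⊥-elim (minimal T (T⊆C , x , x∈C , x∉T) (T , id , T≢∅ , ΣT≡0))

  circuit-nonempty : ∀ {C} → Circuit M C → Nonempty C
  circuit-nonempty ((T , T⊆C , (e , e∈T) , _) , _) = e , T⊆C e∈T

  circuit-minus-independent : ∀ {C e} → Circuit M C → e ∈ C → Independent M (C - e)
  circuit-minus-independent (_ , minimal) e∈C = minimal _ (x∈p⇒p-x⊂p e∈C)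

-- The size of an independent set is at most the number of rows

matroidOf : ∀ {n m} → (Fin n → Vec Bool m) → BinaryMatroid
matroidOf {n} {m} v = record { n = n ; m = m ; vec = v }

head∷tail : ∀ {m} (x : Vec Bool (suc m)) → head x ∷ tail x ≡ x
head∷tail (_ ∷ _) = refl

head-+ᵥ : ∀ {m} (x y : Vec Bool (suc m)) → head (x +ᵥ y) ≡ head x xor head y
head-+ᵥ (_ ∷ _) (_ ∷ _) = refl

tail-additive : ∀ {m} → Additive (tail {n = m})
tail-additive = refl , λ { (_ ∷ _) (_ ∷ _) → refl }

independent-tail : ∀ {n m} {v : Fin n → Vec Bool (suc m)} {S} → (∀ {e} → e ∈ S → head (v e) ≡ false) →
                   Independent (matroidOf v) S → Independent (matroidOf (tail ∘ v)) S
independent-tail {v = v} heads≡false indep (T , T⊆S , T≢∅ , ΣT≡0) = indep (T , T⊆S , T≢∅ , ΣT≡0′)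
  where
  head-false : head (sumSub v T) ≡ false
  head-false = sumSub-closed (λ x → head x ≡ false) refl
    (λ {x} {y} hx hy → trans (head-+ᵥ x y) (cong₂ _xor_ hx hy)) (heads≡false ∘ T⊆S)
  ΣT≡0′ : sumSub v T ≡ 0ᵥ
  ΣT≡0′ = trans (sym (head∷tail _))
                (cong₂ _∷_ head-false (trans (sym (sumSub-additive tail-additive v T)) ΣT≡0))

module Elimination {m} (pivot : Vec Bool (suc m)) where

  multiple : Bool → Vec Bool (suc m)
  multiple b = if b then pivot else 0ᵥ

  multiple-xor : ∀ a b → multiple (a xor b) ≡ multiple a +ᵥ multiple b
  multiple-xor true  true  = sym (+ᵥ-self pivot)
  multiple-xor true  false = sym (+ᵥ-identityʳ pivot)
  multiple-xor false b     = sym (+ᵥ-identityˡ (multiple b))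

  eliminate : Vec Bool (suc m) → Vec Bool m
  eliminate x = tail (x +ᵥ multiple (head x))

  eliminate-additive : Additive eliminate
  eliminate-additive = cong tail (+ᵥ-identityˡ 0ᵥ) , λ x y → begin
    tail ((x +ᵥ y) +ᵥ multiple (head (x +ᵥ y)))
      ≡⟨ cong (λ c → tail ((x +ᵥ y) +ᵥ c))
              (trans (cong multiple (head-+ᵥ x y)) (multiple-xor (head x) (head y))) ⟩
    tail ((x +ᵥ y) +ᵥ (multiple (head x) +ᵥ multiple (head y)))
      ≡⟨ cong tail (+ᵥ-middle x y _ _) ⟩
    tail ((x +ᵥ multiple (head x)) +ᵥ (y +ᵥ multiple (head y)))
      ≡⟨ proj₂ tail-additive (x +ᵥ multiple (head x)) _ ⟩
    eliminate x +ᵥ eliminate y ∎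
    where open ≡-Reasoning

  eliminate≡0 : head pivot ≡ true → ∀ {x} → eliminate x ≡ 0ᵥ → x ≡ multiple (head x)
  eliminate≡0 pivot-head {x} elim≡0 =
    +ᵥ-cancel (trans (sym (head∷tail _)) (cong₂ _∷_ (trans (head-+ᵥ x _) (cancel (head x))) elim≡0))
    where
    cancel : ∀ b → b xor head (multiple b) ≡ false
    cancel true  = cong (true xor_) pivot-head
    cancel false = refl

-- Here S △ ⁅ p ⁆ is S without p.
independent-eliminate : ∀ {n m} {v : Fin n → Vec Bool (suc m)} {S p} → p ∈ S → head (v p) ≡ true →
                        Independent (matroidOf v) S →
                        Independent (matroidOf (Elimination.eliminate (v p) ∘ v)) (S △ ⁅ p ⁆)
independent-eliminate {v = v} {S} {p} p∈S pivot-head indep (T , T⊆S-p , T≢∅ , ΣT≡0) =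
  indep (dependent-by (head (sumSub v T)) refl)
  where
  open Elimination (v p)
  T⊆S : T ⊆ S
  T⊆S x∈T with ∈-△⁻ S ⁅ p ⁆ (T⊆S-p x∈T)
  ... | inj₁ (x∈S , _)      = x∈S
  ... | inj₂ (x∉S , x∈⁅p⁆) = contradiction (subst (_∈ S) (sym (x∈⁅y⁆⇒x≡y p x∈⁅p⁆)) p∈S) x∉S
  p∉T : p ∉ T
  p∉T p∈T with ∈-△⁻ S ⁅ p ⁆ (T⊆S-p p∈T)
  ... | inj₁ (_ , p∉⁅p⁆) = p∉⁅p⁆ (x∈⁅x⁆ p)
  ... | inj₂ (p∉S , _)   = p∉S p∈S
  ΣT≡multiple : sumSub v T ≡ multiple (head (sumSub v T))
  ΣT≡multiple = eliminate≡0 pivot-head (trans (sym (sumSub-additive eliminate-additive v T)) ΣT≡0)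
  dependent-by : ∀ b → head (sumSub v T) ≡ b → Dependent (matroidOf v) S
  dependent-by false h = T , T⊆S , T≢∅ , trans ΣT≡multiple (cong multiple h)
  dependent-by true  h = T △ ⁅ p ⁆ , T+p⊆S , (p , ∈-△⁺ʳ p∉T (x∈⁅x⁆ p)) , ΣT+p≡0
    where
    T+p⊆S : T △ ⁅ p ⁆ ⊆ S
    T+p⊆S x∈ with ∈-△⁻ T ⁅ p ⁆ x∈
    ... | inj₁ (x∈T , _)    = T⊆S x∈T
    ... | inj₂ (_ , x∈⁅p⁆) = subst (_∈ S) (sym (x∈⁅y⁆⇒x≡y p x∈⁅p⁆)) p∈S
    ΣT+p≡0 : sumSub v (T △ ⁅ p ⁆) ≡ 0ᵥ
    ΣT+p≡0 = begin
      sumSub v (T △ ⁅ p ⁆)          ≡⟨ sumSub-△ v T ⁅ p ⁆ ⟩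
      sumSub v T +ᵥ sumSub v ⁅ p ⁆  ≡⟨ cong₂ _+ᵥ_ (trans ΣT≡multiple (cong multiple h)) (sumSub-⁅⁆ v p) ⟩
      v p +ᵥ v p                    ≡⟨ +ᵥ-self (v p) ⟩
      0ᵥ                            ∎
      where open ≡-Reasoning

independent⇒∣∣≤m : ∀ {n} m (v : Fin n → Vec Bool m) {S} → Independent (matroidOf v) S → ∣ S ∣ ≤ m
independent⇒∣∣≤m {n} zero v {S} indep with nonempty? S
... | no  S≢∅       = ≤-reflexive (trans (cong ∣_∣ (Empty-unique S≢∅)) (∣⊥∣≡0 n))
... | yes (x , x∈S) = Empty.⊥-elim (indep (⁅ x ⁆ , ⁅x⁆⊆S , (x , x∈⁅x⁆ x) , empty (sumSub v ⁅ x ⁆)))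
  where
  ⁅x⁆⊆S : ⁅ x ⁆ ⊆ S
  ⁅x⁆⊆S y∈⁅x⁆ = subst (_∈ S) (sym (x∈⁅y⁆⇒x≡y x y∈⁅x⁆)) x∈S
  empty : (u : Vec Bool 0) → u ≡ 0ᵥ
  empty [] = refl
independent⇒∣∣≤m (suc m) v {S} indep with any? (λ p → p ∈? S ×-dec head (v p) ≟ᵇ true)
... | no ∄pivot = m≤n⇒m≤1+n (independent⇒∣∣≤m m (tail ∘ v) (independent-tail no-pivot indep))
  where
  no-pivot : ∀ {e} → e ∈ S → head (v e) ≡ false
  no-pivot {e} e∈S = ¬-not λ h → ∄pivot (e , e∈S , h)
... | yes (p , p∈S , pivot-head) =
  ≤-trans (∣p∣≤1+∣p△⁅x⁆∣ S p) (s≤s (independent⇒∣∣≤m m _ (independent-eliminate p∈S pivot-head indep)))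

-- Direct sums and single-element extensions

0ᵥ++0ᵥ : ∀ m {m′} → 0ᵥ {m} ++ 0ᵥ {m′} ≡ 0ᵥ
0ᵥ++0ᵥ zero    = refl
0ᵥ++0ᵥ (suc m) = cong (false ∷_) (0ᵥ++0ᵥ m)

++-+ᵥ : ∀ {m m′} (x y : Vec Bool m) (x′ y′ : Vec Bool m′) →
        (x ++ x′) +ᵥ (y ++ y′) ≡ (x +ᵥ y) ++ (x′ +ᵥ y′)
++-+ᵥ x y x′ y′ = zipWith-++ _xor_ x x′ y y′

module _ {n₁ n₂ : ℕ} where

  ∈-++⁺ˡ : ∀ {S₁ : Subset n₁} (S₂ : Subset n₂) {x} → x ∈ S₁ → x ↑ˡ n₂ ∈ S₁ ++ S₂
  ∈-++⁺ˡ {S₁} S₂ {x} x∈S₁ = lookup⇒[]= _ _ (trans (lookup-++ˡ S₁ S₂ x) ([]=⇒lookup x∈S₁))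

  ∈-++⁺ʳ : ∀ (S₁ : Subset n₁) {S₂ : Subset n₂} {x} → x ∈ S₂ → n₁ ↑ʳ x ∈ S₁ ++ S₂
  ∈-++⁺ʳ S₁ {S₂} {x} x∈S₂ = lookup⇒[]= _ _ (trans (lookup-++ʳ S₁ S₂ x) ([]=⇒lookup x∈S₂))

  ∈-++⁻ˡ : ∀ (S₁ : Subset n₁) (S₂ : Subset n₂) {x} → x ↑ˡ n₂ ∈ S₁ ++ S₂ → x ∈ S₁
  ∈-++⁻ˡ S₁ S₂ {x} x∈S = lookup⇒[]= _ _ (trans (sym (lookup-++ˡ S₁ S₂ x)) ([]=⇒lookup x∈S))

  ∈-++⁻ʳ : ∀ (S₁ : Subset n₁) (S₂ : Subset n₂) {x} → n₁ ↑ʳ x ∈ S₁ ++ S₂ → x ∈ S₂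
  ∈-++⁻ʳ S₁ S₂ {x} x∈S = lookup⇒[]= _ _ (trans (sym (lookup-++ʳ S₁ S₂ x)) ([]=⇒lookup x∈S))

∣++∣ : ∀ {n₁ n₂} (S₁ : Subset n₁) (S₂ : Subset n₂) → ∣ S₁ ++ S₂ ∣ ≡ ∣ S₁ ∣ + ∣ S₂ ∣
∣++∣ []           S₂ = refl
∣++∣ (true  ∷ S₁) S₂ = cong suc (∣++∣ S₁ S₂)
∣++∣ (false ∷ S₁) S₂ = ∣++∣ S₁ S₂

data Split (n₁ n₂ : ℕ) : Fin (n₁ + n₂) → Set where
  left  : (x : Fin n₁) → Split n₁ n₂ (x ↑ˡ n₂)
  right : (y : Fin n₂) → Split n₁ n₂ (n₁ ↑ʳ y)

split : ∀ n₁ {n₂} (x : Fin (n₁ + n₂)) → Split n₁ n₂ x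
split zero    y       = right y
split (suc n₁) zero    = left zero
split (suc n₁) (suc x) with split n₁ x
... | left  x′ = left (suc x′)
... | right y  = right y

++-suc : ∀ {n₁ n₂} {A : Set} (f : Fin (suc n₁) → A) (g : Fin n₂ → A) i →
         (f Fun.++ g) (suc i) ≡ ((f ∘ suc) Fun.++ g) i
++-suc {n₁} f g i with Data.Fin.splitAt n₁ i
... | inj₁ _ = refl
... | inj₂ _ = refl

sumSub-++ : ∀ {n₁ n₂ m} (f : Fin n₁ → Vec Bool m) (g : Fin n₂ → Vec Bool m) S₁ S₂ →
            sumSub (f Fun.++ g) (S₁ ++ S₂) ≡ sumSub f S₁ +ᵥ sumSub g S₂
sumSub-++ f g []           S₂ = sym (+ᵥ-identityˡ _)
sumSub-++ f g (true  ∷ S₁) S₂ = begin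
  f zero +ᵥ sumSub (λ i → (f Fun.++ g) (suc i)) (S₁ ++ S₂)
    ≡⟨ cong (f zero +ᵥ_) (sumSub-cong (++-suc f g) (S₁ ++ S₂)) ⟩
  f zero +ᵥ sumSub ((f ∘ suc) Fun.++ g) (S₁ ++ S₂)
    ≡⟨ cong (f zero +ᵥ_) (sumSub-++ (f ∘ suc) g S₁ S₂) ⟩
  f zero +ᵥ (sumSub (f ∘ suc) S₁ +ᵥ sumSub g S₂)
    ≡⟨ sym (+ᵥ-assoc (f zero) _ _) ⟩
  (f zero +ᵥ sumSub (f ∘ suc) S₁) +ᵥ sumSub g S₂
    ∎
  where open ≡-Reasoning
sumSub-++ f g (false ∷ S₁) S₂ = trans (sumSub-cong (++-suc f g) (S₁ ++ S₂)) (sumSub-++ (f ∘ suc) g S₁ S₂)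

infixr 5 _⊕_

_⊕_ : BinaryMatroid → BinaryMatroid → BinaryMatroid
M ⊕ N = record
  { n   = n M + n N
  ; m   = m M + m N
  ; vec = (λ e → vec M e ++ 0ᵥ) Fun.++ (λ e → 0ᵥ ++ vec N e)
  }

module _ (M N : BinaryMatroid) where

  sumSub-⊕ : ∀ S₁ S₂ → sumSub (vec (M ⊕ N)) (S₁ ++ S₂) ≡ sumSub (vec M) S₁ ++ sumSub (vec N) S₂
  sumSub-⊕ S₁ S₂ = begin
    sumSub (vec (M ⊕ N)) (S₁ ++ S₂)
      ≡⟨ sumSub-++ _ _ S₁ S₂ ⟩
    sumSub ((_++ 0ᵥ) ∘ vec M) S₁ +ᵥ sumSub ((0ᵥ ++_) ∘ vec N) S₂
      ≡⟨ cong₂ _+ᵥ_ (sumSub-additive ++0-additive (vec M) S₁) (sumSub-additive 0++-additive (vec N) S₂) ⟩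
    (ΣS₁ ++ 0ᵥ) +ᵥ (0ᵥ ++ ΣS₂)
      ≡⟨ ++-+ᵥ ΣS₁ 0ᵥ 0ᵥ ΣS₂ ⟩
    (ΣS₁ +ᵥ 0ᵥ) ++ (0ᵥ +ᵥ ΣS₂)
      ≡⟨ cong₂ _++_ (+ᵥ-identityʳ ΣS₁) (+ᵥ-identityˡ ΣS₂) ⟩
    ΣS₁ ++ ΣS₂ ∎
    where
    open ≡-Reasoning
    ΣS₁ = sumSub (vec M) S₁
    ΣS₂ = sumSub (vec N) S₂
    ++0-additive : Additive (λ (x : Vec Bool (m M)) → x ++ 0ᵥ {m N})
    ++0-additive = 0ᵥ++0ᵥ (m M) , λ x y →
      trans (cong ((x +ᵥ y) ++_) (sym (+ᵥ-identityˡ 0ᵥ))) (sym (++-+ᵥ x y 0ᵥ 0ᵥ))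
    0++-additive : Additive (λ (x : Vec Bool (m N)) → 0ᵥ {m M} ++ x)
    0++-additive = 0ᵥ++0ᵥ (m M) , λ x y →
      trans (cong (_++ (x +ᵥ y)) (sym (+ᵥ-identityˡ 0ᵥ))) (sym (++-+ᵥ 0ᵥ 0ᵥ x y))

  ⊕-independent : ∀ {S₁ S₂} → Independent M S₁ → Independent N S₂ → Independent (M ⊕ N) (S₁ ++ S₂)
  ⊕-independent {S₁} {S₂} indep₁ indep₂ (T , T⊆S , (x , x∈T) , ΣT≡0) with splitAt (n M) T
  ... | T₁ , T₂ , refl with ++-injective (sumSub (vec M) T₁) 0ᵥ
                             (trans (sym (sumSub-⊕ T₁ T₂)) (trans ΣT≡0 (sym (0ᵥ++0ᵥ (m M)))))
  ...   | ΣT₁≡0 , ΣT₂≡0 with split (n M) x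
  ...     | left  x₁ =
    indep₁ (T₁ , ∈-++⁻ˡ S₁ S₂ ∘ T⊆S ∘ ∈-++⁺ˡ T₂ , (x₁ , ∈-++⁻ˡ T₁ T₂ x∈T) , ΣT₁≡0)
  ...     | right x₂ =
    indep₂ (T₂ , ∈-++⁻ʳ S₁ S₂ ∘ T⊆S ∘ ∈-++⁺ʳ T₁ , (x₂ , ∈-++⁻ʳ T₁ T₂ x∈T) , ΣT₂≡0)

  ⊕-circuitˡ : ∀ {C} → Circuit M C → Circuit (M ⊕ N) (C ++ ⊥)
  ⊕-circuitˡ {C} circ =
    circuit-intro (M ⊕ N) (⊕-independent (circuit-minus-independent M circ e∈C) (independent-⊥ N))
      (∈-++⁺ˡ ⊥ e∈C) C-e⊆I ΣC≡0
    where
    e = proj₁ (circuit-nonempty M circ)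
    e∈C = proj₂ (circuit-nonempty M circ)
    C-e⊆I : ∀ {x} → x ∈ C ++ ⊥ → x ≢ e ↑ˡ n N → x ∈ (C - e) ++ ⊥
    C-e⊆I {x} x∈ x≢e with split (n M) x
    ... | left  x₁ = ∈-++⁺ˡ ⊥ (x∈p∧x≢y⇒x∈p-y (∈-++⁻ˡ C ⊥ x∈) λ { refl → x≢e refl })
    ... | right x₂ = contradiction (∈-++⁻ʳ C ⊥ x∈) ∉⊥
    ΣC≡0 : sumSub (vec (M ⊕ N)) (C ++ ⊥) ≡ 0ᵥ
    ΣC≡0 = trans (sumSub-⊕ C ⊥)
                 (trans (cong₂ _++_ (circuit-sum≡0 M circ) (sumSub-⊥ (vec N))) (0ᵥ++0ᵥ (m M)))

  ⊕-circuitʳ : ∀ {C} → Circuit N C → Circuit (M ⊕ N) (⊥ ++ C)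
  ⊕-circuitʳ {C} circ =
    circuit-intro (M ⊕ N) (⊕-independent (independent-⊥ M) (circuit-minus-independent N circ e∈C))
      (∈-++⁺ʳ ⊥ e∈C) C-e⊆I ΣC≡0
    where
    e = proj₁ (circuit-nonempty N circ)
    e∈C = proj₂ (circuit-nonempty N circ)
    C-e⊆I : ∀ {x} → x ∈ ⊥ ++ C → x ≢ n M ↑ʳ e → x ∈ ⊥ ++ (C - e)
    C-e⊆I {x} x∈ x≢e with split (n M) x
    ... | left  x₁ = contradiction (∈-++⁻ˡ ⊥ C x∈) ∉⊥
    ... | right x₂ = ∈-++⁺ʳ ⊥ (x∈p∧x≢y⇒x∈p-y (∈-++⁻ʳ ⊥ C x∈) λ { refl → x≢e refl })
    ΣC≡0 : sumSub (vec (M ⊕ N)) (⊥ ++ C) ≡ 0ᵥ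
    ΣC≡0 = trans (sumSub-⊕ ⊥ C)
                 (trans (cong₂ _++_ (sumSub-⊥ (vec M)) (circuit-sum≡0 N circ)) (0ᵥ++0ᵥ (m M)))

⨁ : ℕ → BinaryMatroid → BinaryMatroid
⨁ zero    M = record { n = 0 ; m = 0 ; vec = λ () }
⨁ (suc a) M = M ⊕ ⨁ a M

module _ (M : BinaryMatroid) where

  m-⨁ : ∀ a → m (⨁ a M) ≡ a * m M
  m-⨁ zero    = refl
  m-⨁ (suc a) = cong (m M +_) (m-⨁ a)

  ⨁ₛ : ∀ {a} → (Fin a → Subset (n M)) → Subset (n (⨁ a M))
  ⨁ₛ {zero}  S = []
  ⨁ₛ {suc a} S = S zero ++ ⨁ₛ (S ∘ suc)

  blockₛ : ∀ {a} → Fin a → Subset (n M) → Subset (n (⨁ a M))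
  blockₛ zero    C = C ++ ⊥
  blockₛ (suc j) C = ⊥ ++ blockₛ j C

  block : ∀ {a} → Fin a → Fin (n M) → Fin (n (⨁ a M))
  block {suc a} zero    e = e ↑ˡ n (⨁ a M)
  block {suc a} (suc j) e = n M ↑ʳ block j e

  data InBlock {a} : Fin (n (⨁ a M)) → Set where
    inBlock : (j : Fin a) (e : Fin (n M)) → InBlock {a} (block j e)

  blocks : ∀ {a} (x : Fin (n (⨁ a M))) → InBlock {a} x
  blocks {suc a} x with split (n M) x
  ... | left  e = inBlock zero e
  ... | right y with blocks {a} y
  ...   | inBlock j e = inBlock (suc j) e

  block-injectiveʳ : ∀ {a} (j : Fin a) {e e′} → block j e ≡ block j e′ → e ≡ e′
  block-injectiveʳ {suc a} zero    eq = ↑ˡ-injective _ _ _ eq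
  block-injectiveʳ {suc a} (suc j) eq = block-injectiveʳ j (↑ʳ-injective _ _ _ eq)

  block-∈⨁ₛ⁺ : ∀ {a} {S : Fin a → Subset (n M)} j {e} → e ∈ S j → block j e ∈ ⨁ₛ S
  block-∈⨁ₛ⁺ {suc a} {S} zero    e∈ = ∈-++⁺ˡ (⨁ₛ (S ∘ suc)) e∈
  block-∈⨁ₛ⁺ {suc a} {S} (suc j) e∈ = ∈-++⁺ʳ (S zero) (block-∈⨁ₛ⁺ j e∈)

  block-∈⨁ₛ⁻ : ∀ {a} {S : Fin a → Subset (n M)} j {e} → block j e ∈ ⨁ₛ S → e ∈ S j
  block-∈⨁ₛ⁻ {suc a} {S} zero    e∈ = ∈-++⁻ˡ (S zero) (⨁ₛ (S ∘ suc)) e∈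
  block-∈⨁ₛ⁻ {suc a} {S} (suc j) e∈ = block-∈⨁ₛ⁻ j (∈-++⁻ʳ (S zero) (⨁ₛ (S ∘ suc)) e∈)

  block-∈blockₛ⁺ : ∀ {a} (j : Fin a) {C e} → e ∈ C → block j e ∈ blockₛ j C
  block-∈blockₛ⁺ {suc a} zero    e∈ = ∈-++⁺ˡ ⊥ e∈
  block-∈blockₛ⁺ {suc a} (suc j) e∈ = ∈-++⁺ʳ ⊥ (block-∈blockₛ⁺ j e∈)

  ∈blockₛ⁻ : ∀ {a} (j : Fin a) {C x} → x ∈ blockₛ j C → ∃[ e ] (e ∈ C × x ≡ block j e)
  ∈blockₛ⁻ {suc a} zero    {C} {x} x∈ with split (n M) x
  ... | left  e = e , ∈-++⁻ˡ C ⊥ x∈ , refl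
  ... | right y = contradiction (∈-++⁻ʳ C ⊥ x∈) ∉⊥
  ∈blockₛ⁻ {suc a} (suc j) {C} {x} x∈ with split (n M) x
  ... | left  e = contradiction (∈-++⁻ˡ ⊥ (blockₛ j C) x∈) ∉⊥
  ... | right y with ∈blockₛ⁻ j {x = y} (∈-++⁻ʳ ⊥ (blockₛ j C) x∈)
  ...   | e , e∈C , refl = e , e∈C , refl

  ⨁-independent : ∀ {a} {S : Fin a → Subset (n M)} → (∀ j → Independent M (S j)) →
                  Independent (⨁ a M) (⨁ₛ S)
  ⨁-independent {zero}  indep (T , _ , (() , _) , _)
  ⨁-independent {suc a} indep = ⊕-independent M (⨁ a M) (indep zero) (⨁-independent (indep ∘ suc))

  ⨁-sumSub-cong : ∀ {a} {S S′ : Fin a → Subset (n M)} →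
                  (∀ j → sumSub (vec M) (S j) ≡ sumSub (vec M) (S′ j)) →
                  sumSub (vec (⨁ a M)) (⨁ₛ S) ≡ sumSub (vec (⨁ a M)) (⨁ₛ S′)
  ⨁-sumSub-cong {zero}  ΣS≡ΣS′ = refl
  ⨁-sumSub-cong {suc a} {S} {S′} ΣS≡ΣS′ = begin
    sumSub (vec (⨁ (suc a) M)) (⨁ₛ S)
      ≡⟨ sumSub-⊕ M (⨁ a M) (S zero) _ ⟩
    sumSub (vec M) (S zero) ++ sumSub _ (⨁ₛ (S ∘ suc))
      ≡⟨ cong₂ _++_ (ΣS≡ΣS′ zero) (⨁-sumSub-cong (ΣS≡ΣS′ ∘ suc)) ⟩
    sumSub (vec M) (S′ zero) ++ sumSub _ (⨁ₛ (S′ ∘ suc))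
      ≡⟨ sym (sumSub-⊕ M (⨁ a M) (S′ zero) _) ⟩
    sumSub (vec (⨁ (suc a) M)) (⨁ₛ S′)
      ∎
    where open ≡-Reasoning

  ⨁-circuit : ∀ {a C} → Circuit M C → (j : Fin a) → Circuit (⨁ a M) (blockₛ j C)
  ⨁-circuit {suc a} circ zero    = ⊕-circuitˡ M (⨁ a M) circ
  ⨁-circuit {suc a} circ (suc j) = ⊕-circuitʳ M (⨁ a M) (⨁-circuit circ j)

  ∣⨁ₛ∣ : ∀ a (S : Subset (n M)) → ∣ ⨁ₛ {a} (λ _ → S) ∣ ≡ a * ∣ S ∣
  ∣⨁ₛ∣ zero    S = refl
  ∣⨁ₛ∣ (suc a) S = trans (∣++∣ S _) (cong (∣ S ∣ +_) (∣⨁ₛ∣ a S))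

free : ℕ → BinaryMatroid
free s = record { n = s ; m = s ; vec = ⁅_⁆ }

∷-additive : ∀ {m} → Additive {m} (false ∷_)
∷-additive = refl , λ _ _ → refl

sumSub-units : ∀ {s} (T : Subset s) → sumSub ⁅_⁆ T ≡ T
sumSub-units []          = refl
sumSub-units (true  ∷ T) = begin
  (true ∷ ⊥) +ᵥ sumSub ((false ∷_) ∘ ⁅_⁆) T  ≡⟨ cong ((true ∷ ⊥) +ᵥ_) (sumSub-additive ∷-additive ⁅_⁆ T) ⟩
  true ∷ (⊥ +ᵥ sumSub ⁅_⁆ T)                 ≡⟨ cong (true ∷_) (trans (+ᵥ-identityˡ _) (sumSub-units T)) ⟩
  true ∷ T                                   ∎
  where open ≡-Reasoning
sumSub-units (false ∷ T) = trans (sumSub-additive ∷-additive ⁅_⁆ T) (cong (false ∷_) (sumSub-units T))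

free-independent : ∀ s → Independent (free s) ⊤
free-independent s (T , _ , (x , x∈T) , ΣT≡0) = ∉⊥ (subst (x ∈_) (trans (sym (sumSub-units T)) ΣT≡0) x∈T)

extend : (M : BinaryMatroid) → Vec Bool (m M) → BinaryMatroid
extend M w = record { n = suc (n M) ; m = m M ; vec = w Fun.∷ vec M }

module _ (M : BinaryMatroid) (w : Vec Bool (m M)) where

  extend-independent : ∀ {S} → Independent M S → Independent (extend M w) (false ∷ S)
  extend-independent indep (true ∷ T , T⊆S , _) = contradiction (T⊆S here) λ ()
  extend-independent indep (false ∷ T , T⊆S , (suc x , there x∈T) , ΣT≡0) =
    indep (T , (λ y∈T → drop-there (T⊆S (there y∈T))) , (x , x∈T) , ΣT≡0)

  extend-independent-new : ∀ {S} i → Independent M S → lookup w i ≡ true →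
                           (∀ {e} → e ∈ S → lookup (vec M e) i ≡ false) → Independent (extend M w) (true ∷ S)
  extend-independent-new {S} i indep wᵢ≡true S⊆ker (false ∷ T , T⊆S , (suc x , there x∈T) , ΣT≡0) =
    indep (T , (λ y∈T → drop-there (T⊆S (there y∈T))) , (x , x∈T) , ΣT≡0)
  extend-independent-new {S} i indep wᵢ≡true S⊆ker (true ∷ T , T⊆S , _ , ΣT≡0) = true≢false (begin
    true                                           ≡⟨ sym (cong₂ _xor_ wᵢ≡true ΣTᵢ≡false) ⟩
    lookup w i xor lookup (sumSub (vec M) T) i     ≡⟨ sym (lookup-zipWith _xor_ i w _) ⟩
    lookup (w +ᵥ sumSub (vec M) T) i               ≡⟨ cong (λ x → lookup x i) ΣT≡0 ⟩
    lookup 0ᵥ i                                    ≡⟨ lookup-replicate i false ⟩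
    false                                          ∎)
    where
    open ≡-Reasoning
    true≢false : true ≢ false
    true≢false ()
    ΣTᵢ≡false : lookup (sumSub (vec M) T) i ≡ false
    ΣTᵢ≡false = sumSub-closed (λ x → lookup x i ≡ false) (lookup-replicate i false)
      (λ {x} {y} xᵢ≡false yᵢ≡false → trans (lookup-zipWith _xor_ i x y) (cong₂ _xor_ xᵢ≡false yᵢ≡false))
      (λ y∈T → S⊆ker (drop-there (T⊆S (there y∈T))))

  extend-circuit : ∀ {C} → Circuit M C → Circuit (extend M w) (false ∷ C)
  extend-circuit {C} circ =
    circuit-intro (extend M w) (extend-independent (circuit-minus-independent M circ e∈C))
      (there e∈C) C-e⊆I (circuit-sum≡0 M circ)
    where
    e = proj₁ (circuit-nonempty M circ)
    e∈C = proj₂ (circuit-nonempty M circ)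
    C-e⊆I : ∀ {x} → x ∈ false ∷ C → x ≢ suc e → x ∈ false ∷ (C - e)
    C-e⊆I {suc x} (there x∈C) x≢e = there (x∈p∧x≢y⇒x∈p-y x∈C λ { refl → x≢e refl })

  fundamental-circuit : ∀ {S} → Independent M S → sumSub (vec M) S ≡ w → Circuit (extend M w) (true ∷ S)
  fundamental-circuit {S} indep ΣS≡w =
    circuit-intro (extend M w) (extend-independent indep) here S⊆I
      (trans (cong (w +ᵥ_) ΣS≡w) (+ᵥ-self w))
    where
    S⊆I : ∀ {x} → x ∈ true ∷ S → x ≢ zero → x ∈ false ∷ S
    S⊆I here        0≢0 = contradiction refl 0≢0
    S⊆I (there x∈S) _   = there x∈S


-- The affine geometry AG(3,2)

-- A point x of GF(2)³ (encoded as Fin 8 through its bits) is represented by the vector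
-- (1, x) of GF(2)⁴; four distinct points are a circuit exactly when they sum to zero.
bits : Fin 8 → Vec Bool 3
bits = lookup ( (false ∷ false ∷ false ∷ [])
              ∷ (true  ∷ false ∷ false ∷ [])
              ∷ (false ∷ true  ∷ false ∷ [])
              ∷ (true  ∷ true  ∷ false ∷ [])
              ∷ (false ∷ false ∷ true  ∷ [])
              ∷ (true  ∷ false ∷ true  ∷ [])
              ∷ (false ∷ true  ∷ true  ∷ [])
              ∷ (true  ∷ true  ∷ true  ∷ [])
              ∷ [])

fromBits : Vec Bool 3 → Fin 8
fromBits (false ∷ false ∷ false ∷ []) = # 0
fromBits (true  ∷ false ∷ false ∷ []) = # 1
fromBits (false ∷ true  ∷ false ∷ []) = # 2
fromBits (true  ∷ true  ∷ false ∷ []) = # 3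
fromBits (false ∷ false ∷ true  ∷ []) = # 4
fromBits (true  ∷ false ∷ true  ∷ []) = # 5
fromBits (false ∷ true  ∷ true  ∷ []) = # 6
fromBits (true  ∷ true  ∷ true  ∷ []) = # 7

AG : BinaryMatroid
AG = record { n = 8 ; m = 4 ; vec = λ x → true ∷ bits x }

infixl 6 _+ᵖ_

_+ᵖ_ : Fin 8 → Fin 8 → Fin 8
x +ᵖ y = fromBits (bits x +ᵥ bits y)

Plane : Vec (Fin 8) 4 → Set
Plane (a ∷ b ∷ c ∷ d ∷ []) = a +ᵖ b +ᵖ c +ᵖ d ≡ zero

plane? : ∀ q → Dec (Plane q)
plane? (a ∷ b ∷ c ∷ d ∷ []) = a +ᵖ b +ᵖ c +ᵖ d ≟ zero

unique? : ∀ {n l} (q : Vec (Fin n) l) → Dec (Unique q)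
unique? = allPairs? λ x y → ¬? (x ≟ y)

points : ∀ {n l} → Vec (Fin n) l → Subset n
points []      = ⊥
points (x ∷ q) = ⁅ x ⁆ ∪ points q

∈-points⁺ : ∀ {n l} (q : Vec (Fin n) l) i → lookup q i ∈ points q
∈-points⁺ (x ∷ q) zero    = x∈p∪q⁺ (inj₁ (x∈⁅x⁆ x))
∈-points⁺ (x ∷ q) (suc i) = x∈p∪q⁺ (inj₂ (∈-points⁺ q i))

∈-points⁻ : ∀ {n l} (q : Vec (Fin n) l) {y} → y ∈ points q → ∃[ i ] lookup q i ≡ y
∈-points⁻ []      y∈ = contradiction y∈ ∉⊥
∈-points⁻ (x ∷ q) {y} y∈ with x∈p∪q⁻ ⁅ x ⁆ (points q) y∈
... | inj₁ y∈⁅x⁆ = zero , sym (x∈⁅y⁆⇒x≡y x y∈⁅x⁆)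
... | inj₂ y∈q with ∈-points⁻ q y∈q
...   | i , eq = suc i , eq

-- The facts about AG(3,2) below are checked by exhaustive search; they are opaque so that
-- no later definition unfolds the search.
opaque
  plane-circuit-data : ∀ a b c d → Unique (a ∷ b ∷ c ∷ d ∷ []) → Plane (a ∷ b ∷ c ∷ d ∷ []) →
    Independent AG (points (b ∷ c ∷ d ∷ [])) × sumSub (vec AG) (points (a ∷ b ∷ c ∷ d ∷ [])) ≡ 0ᵥ
  plane-circuit-data = toWitness {a? = all? λ a → all? λ b → all? λ c → all? λ d →
    unique? (a ∷ b ∷ c ∷ d ∷ []) →-dec (plane? (a ∷ b ∷ c ∷ d ∷ []) →-dec
      (independent? AG (points (b ∷ c ∷ d ∷ []))
        ×-dec ≡-dec _≟ᵇ_ (sumSub (vec AG) (points (a ∷ b ∷ c ∷ d ∷ []))) 0ᵥ))} _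

plane-circuit : ∀ q → Unique q → Plane q → Circuit AG (points q)
plane-circuit q@(a ∷ b ∷ c ∷ d ∷ []) distinct plane with plane-circuit-data a b c d distinct plane
... | indep , Σ≡0 = circuit-intro AG indep (∈-points⁺ q zero) rest Σ≡0
  where
  rest : ∀ {x} → x ∈ points q → x ≢ a → x ∈ points (b ∷ c ∷ d ∷ [])
  rest x∈ x≢a with x∈p∪q⁻ ⁅ a ⁆ _ x∈
  ... | inj₁ x∈⁅a⁆  = contradiction (x∈⁅y⁆⇒x≡y a x∈⁅a⁆) x≢a
  ... | inj₂ x∈rest = x∈rest

planeThrough : Fin 8 → Fin 8 → Vec (Fin 8) 4
planeThrough x y = x ∷ y ∷ z ∷ x +ᵖ y +ᵖ z ∷ []
  where z = x +ᵖ (if ⌊ x +ᵖ y ≟ # 1 ⌋ then # 2 else # 1)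

opaque
  plane-through : ∀ x y → x ≢ y → Unique (planeThrough x y) × Plane (planeThrough x y)
  plane-through = toWitness {a? = all? λ x → all? λ y →
    ¬? (x ≟ y) →-dec (unique? (planeThrough x y) ×-dec plane? (planeThrough x y))} _

OriginSubstitute : Subset 8 → Set
OriginSubstitute X = Independent AG X × sumSub (vec AG) X ≡ vec AG zero

-- For p ≠ 0 the line {p, q, p + q} with q ∉ {0, p} has vector sum (1, 0), the vector of
-- the origin.
originSubstitute : Fin 8 → Subset 8
originSubstitute zero    = ⁅ zero ⁆
originSubstitute (suc p) = points (suc p ∷ q ∷ suc p +ᵖ q ∷ [])
  where q = if ⌊ suc p ≟ # 1 ⌋ then # 2 else # 1

opaque
  origin-substitute : ∀ p → p ∈ originSubstitute p × OriginSubstitute (originSubstitute p)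
  origin-substitute = toWitness {a? = all? λ p →
    p ∈? originSubstitute p ×-dec independent? AG (originSubstitute p)
      ×-dec ≡-dec _≟ᵇ_ (sumSub (vec AG) (originSubstitute p)) (vec AG zero)} _

basis : Subset 8
basis = points (# 0 ∷ # 1 ∷ # 2 ∷ # 4 ∷ [])

opaque
  basis-independent : Independent AG basis × Independent AG (∁ basis)
  basis-independent = toWitness {a? = independent? AG basis ×-dec independent? AG (∁ basis)} _

others : Fin 4 → Vec (Fin 4) 3
others = removeAt (allFin 4)

opaque
  others-avoid : ∀ i j → lookup (others i) j ≢ i
  others-avoid = toWitness {a? = all? λ i → all? λ j → ¬? (lookup (others i) j ≟ i)} _

  others-injective : ∀ i j j′ → lookup (others i) j ≡ lookup (others i) j′ → j ≡ j′
  others-injective = toWitness {a? = all? λ i → all? λ j → all? λ j′ →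
    (lookup (others i) j ≟ lookup (others i) j′) →-dec (j ≟ j′)} _

-- The sum of the points of P other than P i.
fourth : Vec (Fin 8) 4 → Fin 4 → Fin 8
fourth P i = (lookup P (# 0) +ᵖ lookup P (# 1) +ᵖ lookup P (# 2) +ᵖ lookup P (# 3)) +ᵖ lookup P i

record FourthPoints (P : Vec (Fin 8) 4) : Set where
  field
    plane-with-others : ∀ i → Plane (fourth P i ∷ map (lookup P) (others i))
    apart             : ∀ i j → lookup P i ≢ fourth P j
    injective         : ∀ i j → fourth P i ≡ fourth P j → i ≡ j
    plane-with-pair   : ∀ i j → i ≢ j → Plane (lookup P i ∷ lookup P j ∷ fourth P i ∷ fourth P j ∷ [])

fourth-points? : ∀ P → Dec (FourthPoints P)
fourth-points? P = map′ (λ { (p₁ , p₂ , p₃ , p₄) → record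
    { plane-with-others = p₁ ; apart = p₂ ; injective = p₃ ; plane-with-pair = p₄ } })
  (λ f → plane-with-others f , apart f , injective f , plane-with-pair f)
  ( all? (λ i → plane? (fourth P i ∷ map (lookup P) (others i)))
    ×-dec all? (λ i → all? λ j → ¬? (lookup P i ≟ fourth P j))
    ×-dec all? (λ i → all? λ j → (fourth P i ≟ fourth P j) →-dec (i ≟ j))
    ×-dec all? (λ i → all? λ j → ¬? (i ≟ j) →-dec
                 plane? (lookup P i ∷ lookup P j ∷ fourth P i ∷ fourth P j ∷ [])))
  where open FourthPoints

opaque
  fourth-points : ∀ P → Unique P → ¬ Plane P → FourthPoints P
  fourth-points (a ∷ b ∷ c ∷ d ∷ []) = search a b c d
    where
    search : ∀ a b c d → let P = a ∷ b ∷ c ∷ d ∷ [] in Unique P → ¬ Plane P → FourthPoints P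
    search = toWitness {a? = all? λ a → all? λ b → all? λ c → all? λ d → let P = a ∷ b ∷ c ∷ d ∷ [] in
      unique? P →-dec (¬? (plane? P) →-dec fourth-points? P)} _

-- Colourings of AG(3,2)

Repeated : ∀ {A B : Set} {l} → (A → B) → Vec A l → Set
Repeated f q = ∃[ i ] ∃[ j ] (i ≢ j × f (lookup q i) ≡ f (lookup q j))

Rainbow : ∀ {A B : Set} {l} → (A → B) → Vec A l → Set
Rainbow f q = Unique (map f q)

rainbow-injective : ∀ {A B : Set} {l} {f : A → B} {q : Vec A l} → Rainbow f q →
                    ∀ i j → f (lookup q i) ≡ f (lookup q j) → i ≡ j
rainbow-injective {f = f} {q} rainbow i j eq =
  lookup-injective rainbow i j (trans (lookup-map i f q) (trans eq (sym (lookup-map j f q))))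

repeated-head : ∀ {A B : Set} {l} {f : A → B} {x} {xs : Vec A l} → Repeated f (x ∷ xs) →
                (∀ j j′ → f (lookup xs j) ≡ f (lookup xs j′) → j ≡ j′) → ∃[ j ] f x ≡ f (lookup xs j)
repeated-head (zero  , zero   , 0≢0  , _)  _   = contradiction refl 0≢0
repeated-head (zero  , suc j  , _    , eq) _   = j , eq
repeated-head (suc j , zero   , _    , eq) _   = j , sym eq
repeated-head (suc j , suc j′ , j≢j′ , eq) inj = contradiction (cong suc (inj j j′ eq)) j≢j′

repeated-relabel : ∀ {A B C : Set} {l} {f : A → C} {h : B → C} {q : Vec A l} {ℓ : Vec B l} →
                   (∀ t → f (lookup q t) ≡ h (lookup ℓ t)) → (∀ {b b′} → h b ≡ h b′ → b ≡ b′) →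
                   Repeated f q → Repeated id ℓ
repeated-relabel f≡h h-injective (i , j , i≢j , eq) =
  i , j , i≢j , h-injective (trans (sym (f≡h i)) (trans eq (f≡h j)))

repeated? : ∀ {n l} (ℓ : Vec (Fin n) l) → Dec (Repeated id ℓ)
repeated? ℓ = any? λ i → any? λ j → ¬? (i ≟ j) ×-dec lookup ℓ i ≟ lookup ℓ j

unique-or-repeated : ∀ {n l} (q : Vec (Fin n) l) → Unique q ⊎ Repeated id q
unique-or-repeated q with repeated? q
... | yes repeated = inj₂ repeated
... | no ¬repeated = inj₁ (subst Unique (tabulate∘lookup q) (tabulate⁺ λ {i} {j} eq →
        decidable-stable (i ≟ j) λ i≢j → ¬repeated (i , j , i≢j , eq)))

Derangement : Vec (Fin 4) 4 → Set
Derangement g = ∀ i → lookup g i ≢ i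

Linked : Vec (Fin 4) 4 → Set
Linked g = ∀ i j → i ≢ j → Repeated id (i ∷ j ∷ lookup g i ∷ lookup g j ∷ [])

SmallFibres : Vec (Fin 4) 4 → Set
SmallFibres g = ∀ x y z → ¬ (Unique (x ∷ y ∷ z ∷ []) × lookup g y ≡ lookup g x × lookup g z ≡ lookup g x)

no-linked-derangement : ∀ g → Derangement g → Linked g → ¬ SmallFibres g
no-linked-derangement (a ∷ b ∷ c ∷ d ∷ []) derangement linked = search a b c d derangement linked
  where
  search : ∀ a b c d → let g = a ∷ b ∷ c ∷ d ∷ [] in Derangement g → Linked g → ¬ SmallFibres g
  search = toWitness {a? = all? λ a → all? λ b → all? λ c → all? λ d → let g = a ∷ b ∷ c ∷ d ∷ [] in
    all? (λ i → ¬? (lookup g i ≟ i))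
    →-dec (all? (λ i → all? λ j → ¬? (i ≟ j) →-dec repeated? (i ∷ j ∷ lookup g i ∷ lookup g j ∷ []))
    →-dec ¬? (all? λ x → all? λ y → all? λ z →
                ¬? (unique? (x ∷ y ∷ z ∷ []) ×-dec lookup g y ≟ lookup g x ×-dec lookup g z ≟ lookup g x)))} _

module _ {k} (col : Fin 8 → Fin k)
         (planes-repeat : ∀ q → Plane q → Repeated col q)
         (no-monochromatic-four : ∀ {a b c d} → Unique (a ∷ b ∷ c ∷ d ∷ []) →
                                  col b ≡ col a → col c ≡ col a → col d ≢ col a) where

  module _ (P : Vec (Fin 8) 4) (rainbow : Rainbow col P) where

    colour-injective : ∀ {i j} → col (lookup P i) ≡ col (lookup P j) → i ≡ j
    colour-injective = rainbow-injective {f = col} {q = P} rainbow _ _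

    distinct : Unique P
    distinct = subst Unique (tabulate∘lookup P) (tabulate⁺ (colour-injective ∘ cong col))

    not-plane : ¬ Plane P
    not-plane plane with planes-repeat P plane
    ... | i , j , i≢j , eq = i≢j (colour-injective eq)

    open FourthPoints (fourth-points P distinct not-plane)

    others-rainbow : ∀ i j j′ → let xs = map (lookup P) (others i) in
                     col (lookup xs j) ≡ col (lookup xs j′) → j ≡ j′
    others-rainbow i j j′ eq = others-injective i j j′ (colour-injective
      (trans (cong col (sym (lookup-map j (lookup P) (others i))))
             (trans eq (cong col (lookup-map j′ (lookup P) (others i))))))

    -- The plane through fourth P i and the other three points of P repeats a colour.
    matching : ∀ i → ∃[ j ] col (fourth P i) ≡ col (lookup P (lookup (others i) j))
    matching i with repeated-head {f = col} {xs = map (lookup P) (others i)}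
                      (planes-repeat (fourth P i ∷ map (lookup P) (others i)) (plane-with-others i)) (others-rainbow i)
    ... | j , eq = j , trans eq (cong col (lookup-map j (lookup P) (others i)))

    partner : Fin 4 → Fin 4
    partner i = lookup (others i) (proj₁ (matching i))

    partners : Vec (Fin 4) 4
    partners = tabulate partner

    colour-fourth : ∀ i → col (fourth P i) ≡ col (lookup P (lookup partners i))
    colour-fourth i = trans (proj₂ (matching i)) (cong (col ∘ lookup P) (sym (lookup∘tabulate partner i)))

    partners-derangement : Derangement partners
    partners-derangement i eq = others-avoid i (proj₁ (matching i)) (trans (sym (lookup∘tabulate partner i)) eq)

    partners-linked : Linked partners
    partners-linked i j i≢j =
      repeated-relabel {f = col} {h = col ∘ lookup P} {q = plane} {ℓ = labels} colours colour-injective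
        (planes-repeat plane (plane-with-pair i j i≢j))
      where
      plane  = lookup P i ∷ lookup P j ∷ fourth P i ∷ fourth P j ∷ []
      labels = i ∷ j ∷ lookup partners i ∷ lookup partners j ∷ []
      colours : ∀ t → col (lookup plane t) ≡ col (lookup P (lookup labels t))
      colours zero                   = refl
      colours (suc zero)             = refl
      colours (suc (suc zero))       = colour-fourth i
      colours (suc (suc (suc zero))) = colour-fourth j

    partners-small-fibres : SmallFibres partners
    partners-small-fibres x y z (((x≢y ∷ x≢z ∷ []) ∷ (y≢z ∷ []) ∷ [] ∷ []) , y~x , z~x) =
      no-monochromatic-four four-points (colour-fourth x) (same-colour y y~x) (same-colour z z~x)
      where
      fourth-apart : ∀ {i j} → i ≢ j → fourth P i ≢ fourth P j
      fourth-apart i≢j eq = i≢j (injective _ _ eq)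
      four-points : Unique (lookup P (lookup partners x) ∷ fourth P x ∷ fourth P y ∷ fourth P z ∷ [])
      four-points = (apart _ x ∷ apart _ y ∷ apart _ z ∷ [])
                  ∷ (fourth-apart x≢y ∷ fourth-apart x≢z ∷ [])
                  ∷ (fourth-apart y≢z ∷ [])
                  ∷ [] ∷ []
      same-colour : ∀ t → lookup partners t ≡ lookup partners x →
                    col (fourth P t) ≡ col (lookup P (lookup partners x))
      same-colour t t~x = trans (colour-fourth t) (cong (col ∘ lookup P) t~x)

  no-rainbow-quadruple : ∀ P → ¬ Rainbow col P
  no-rainbow-quadruple P rainbow = no-linked-derangement (partners P rainbow)
    (partners-derangement P rainbow) (partners-linked P rainbow) (partners-small-fibres P rainbow)

colour-outside : ∀ {n k r} (col : Fin n → Fin k) (cs : Vec (Fin k) r) →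
                 (∀ x → col x ∈ᵥ cs) ⊎ ∃[ x ] col x ∉ᵥ cs
colour-outside col cs with all? (λ x → Any.any? (col x ≟_) cs)
... | yes all-in = inj₁ all-in
... | no ¬all-in = inj₂ (¬∀⟶∃¬ _ _ (λ x → Any.any? (col x ≟_) cs) ¬all-in)

at-most-three-colours : ∀ {n k} (col : Fin n → Fin k) x₀ → (∀ P → ¬ Rainbow col P) →
                        ∃[ u ] ∃[ v ] ∀ x → col x ∈ᵥ col x₀ ∷ col u ∷ col v ∷ []
at-most-three-colours col x₀ no-rainbow with colour-outside col (col x₀ ∷ [])
... | inj₁ in₁ = x₀ , x₀ , Anyₚ.++⁺ˡ ∘ in₁
... | inj₂ (q , q∉) with colour-outside col (col x₀ ∷ col q ∷ [])
...   | inj₁ in₂ = q , q , Anyₚ.++⁺ˡ ∘ in₂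
...   | inj₂ (s , s∉) with colour-outside col (col x₀ ∷ col q ∷ col s ∷ [])
...     | inj₁ in₃ = q , s , in₃
...     | inj₂ (t , t∉) = contradiction rainbow (no-rainbow (x₀ ∷ q ∷ s ∷ t ∷ []))
  where
  rainbow : Rainbow col (x₀ ∷ q ∷ s ∷ t ∷ [])
  rainbow = ((q∉ ∘ Any.here ∘ sym) ∷ (s∉ ∘ Any.here ∘ sym) ∷ (t∉ ∘ Any.here ∘ sym) ∷ [])
          ∷ ((s∉ ∘ Any.there ∘ Any.here ∘ sym) ∷ (t∉ ∘ Any.there ∘ Any.here ∘ sym) ∷ [])
          ∷ ((t∉ ∘ Any.there ∘ Any.there ∘ Any.here ∘ sym) ∷ [])
          ∷ [] ∷ []

-- The witness matroid

module Witness (a b : ℕ) where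

  D : BinaryMatroid
  D = ⨁ a AG ⊕ free (suc b)

  everyBlock : Subset 8 → Subset (n (⨁ a AG))
  everyBlock X = ⨁ₛ AG {a} (const X)

  link : Vec Bool (m D)
  link = sumSub (vec D) (everyBlock ⁅ zero ⁆ ++ ⊤)

  M : BinaryMatroid
  M = extend D link

  pt : Fin a → Fin 8 → Fin (n M)
  pt j p = suc (block AG j p ↑ˡ suc b)

  fr : Fin (suc b) → Fin (n M)
  fr i = suc (n (⨁ a AG) ↑ʳ i)

  pt-injective : ∀ j {p p′} → pt j p ≡ pt j p′ → p ≡ p′
  pt-injective j eq = block-injectiveʳ AG j (↑ˡ-injective _ _ _ (suc-injective eq))

  data Element : Fin (n M) → Set where
    new   : Element zero
    point : ∀ j p → Element (pt j p)
    unit  : ∀ i → Element (fr i)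

  element : ∀ x → Element x
  element zero    = new
  element (suc x) with split (n (⨁ a AG)) x
  ... | right i = unit i
  ... | left y with blocks AG {a} y
  ...   | inBlock j p = point j p

  linkSet : (Fin a → Subset 8) → Subset (n M)
  linkSet o = true ∷ (⨁ₛ AG o ++ ⊤)

  blockSet : Fin a → Subset 8 → Subset (n M)
  blockSet j C = false ∷ (blockₛ AG j C ++ ⊥)

  Substitutes : (Fin a → Subset 8) → Set
  Substitutes o = ∀ j → OriginSubstitute (o j)

  link-circuit : ∀ {o} → Substitutes o → Circuit M (linkSet o)
  link-circuit {o} substitutes = fundamental-circuit D link
    (⊕-independent (⨁ a AG) (free (suc b)) (⨁-independent AG {S = o} (proj₁ ∘ substitutes))
      (free-independent (suc b)))
    (begin
      sumSub (vec D) (⨁ₛ AG o ++ ⊤)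
        ≡⟨ sumSub-⊕ (⨁ a AG) (free (suc b)) (⨁ₛ AG o) ⊤ ⟩
      sumSub (vec (⨁ a AG)) (⨁ₛ AG o) ++ sumSub ⁅_⁆ ⊤
        ≡⟨ cong (_++ sumSub ⁅_⁆ ⊤) (⨁-sumSub-cong AG {S = o} {S′ = const ⁅ zero ⁆} origin-sum) ⟩
      sumSub (vec (⨁ a AG)) (everyBlock ⁅ zero ⁆) ++ sumSub ⁅_⁆ ⊤
        ≡⟨ sym (sumSub-⊕ (⨁ a AG) (free (suc b)) (everyBlock ⁅ zero ⁆) ⊤) ⟩
      link
        ∎)
    where
    open ≡-Reasoning
    origin-sum : ∀ j → sumSub (vec AG) (o j) ≡ sumSub (vec AG) ⁅ zero ⁆
    origin-sum j = trans (proj₂ (substitutes j)) (sym (sumSub-⁅⁆ (vec AG) zero))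

  block-circuit : ∀ {C} → Circuit AG C → ∀ j → Circuit M (blockSet j C)
  block-circuit circ j = extend-circuit D link (⊕-circuitˡ (⨁ a AG) (free (suc b)) (⨁-circuit AG {a} circ j))

  fr∈linkSet : ∀ o i → fr i ∈ linkSet o
  fr∈linkSet o i = there (∈-++⁺ʳ (⨁ₛ AG o) ∈⊤)

  pt∈linkSet⁺ : ∀ {o j p} → p ∈ o j → pt j p ∈ linkSet o
  pt∈linkSet⁺ {o} {j} p∈ = there (∈-++⁺ˡ ⊤ (block-∈⨁ₛ⁺ AG j p∈))

  pt∈linkSet⁻ : ∀ {o j p} → pt j p ∈ linkSet o → p ∈ o j
  pt∈linkSet⁻ {o} {j} (there p∈) = block-∈⨁ₛ⁻ AG j (∈-++⁻ˡ (⨁ₛ AG o) ⊤ p∈)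

  pt∈blockSet⁺ : ∀ {C j p} → p ∈ C → pt j p ∈ blockSet j C
  pt∈blockSet⁺ {C} {j} p∈ = there (∈-++⁺ˡ ⊥ (block-∈blockₛ⁺ AG j p∈))

  ∈blockSet⁻ : ∀ {C j x} → x ∈ blockSet j C → ∃[ p ] (p ∈ C × x ≡ pt j p)
  ∈blockSet⁻ {C} {j} {suc x} (there x∈) with split (n (⨁ a AG)) x
  ... | right i = contradiction (∈-++⁻ʳ (blockₛ AG j C) ⊥ x∈) ∉⊥
  ... | left y with ∈blockₛ⁻ AG j (∈-++⁻ˡ (blockₛ AG j C) ⊥ x∈)
  ...   | p , p∈C , refl = p , p∈C , refl

  basisSet : Subset (n M)
  basisSet = false ∷ (everyBlock basis ++ ⊤)

  coBasisSet : Subset (n M)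
  coBasisSet = true ∷ (everyBlock (∁ basis) ++ ⊥)

  basisSet-independent : Independent M basisSet
  basisSet-independent = extend-independent D link (⊕-independent (⨁ a AG) (free (suc b))
    (⨁-independent AG {a} {const basis} (const (proj₁ basis-independent))) (free-independent (suc b)))

  coBasisSet-independent : Independent M coBasisSet
  coBasisSet-independent = extend-independent-new D link unit₀
    (⊕-independent (⨁ a AG) (free (suc b))
      (⨁-independent AG {a} {const (∁ basis)} (const (proj₂ basis-independent))) (independent-⊥ (free (suc b))))
    link-unit-coordinate points-unit-coordinate
    where
    open ≡-Reasoning
    unit₀ = m (⨁ a AG) ↑ʳ zero
    link-unit-coordinate : lookup link unit₀ ≡ true
    link-unit-coordinate = begin
      lookup link unit₀
        ≡⟨ cong (λ v → lookup v unit₀) (sumSub-⊕ (⨁ a AG) (free (suc b)) (everyBlock ⁅ zero ⁆) ⊤) ⟩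
      lookup (sumSub (vec (⨁ a AG)) (everyBlock ⁅ zero ⁆) ++ sumSub ⁅_⁆ ⊤) unit₀
        ≡⟨ lookup-++ʳ (sumSub (vec (⨁ a AG)) (everyBlock ⁅ zero ⁆)) (sumSub ⁅_⁆ ⊤) zero ⟩
      lookup (sumSub ⁅_⁆ (⊤ {suc b})) zero
        ≡⟨ cong (λ v → lookup v zero) (sumSub-units {suc b} ⊤) ⟩
      true ∎
    points-unit-coordinate : ∀ {e} → e ∈ everyBlock (∁ basis) ++ ⊥ → lookup (vec D e) unit₀ ≡ false
    points-unit-coordinate {e} e∈ with split (n (⨁ a AG)) e
    ... | right i = contradiction (∈-++⁻ʳ (everyBlock (∁ basis)) ⊥ e∈) ∉⊥
    ... | left y = begin
      lookup (vec D (y ↑ˡ suc b)) unit₀    ≡⟨ cong (λ v → lookup v unit₀) (Funₚ.lookup-++ˡ _ _ y) ⟩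
      lookup (vec (⨁ a AG) y ++ 0ᵥ) unit₀  ≡⟨ lookup-++ʳ (vec (⨁ a AG) y) 0ᵥ zero ⟩
      false                                ∎

  covered : ∀ x → x ∈ basisSet ∪ coBasisSet
  covered x with element x
  ... | new     = q⊆p∪q basisSet coBasisSet here
  ... | unit i  = p⊆p∪q {p = basisSet} coBasisSet (there (∈-++⁺ʳ (everyBlock basis) ∈⊤))
  ... | point j p with p ∈? basis
  ...   | yes p∈ = p⊆p∪q {p = basisSet} coBasisSet (there (∈-++⁺ˡ ⊤ (block-∈⨁ₛ⁺ AG j p∈)))
  ...   | no  p∉ = q⊆p∪q basisSet coBasisSet
                       (there (∈-++⁺ˡ ⊥ (block-∈⨁ₛ⁺ AG j (x∉p⇒x∈∁p p∉))))

  two-coverable : TwoCoverable M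
  two-coverable = basisSet , coBasisSet , basisSet-independent , coBasisSet-independent ,
                  ⊆-antisym ⊆⊤ (λ {x} _ → covered x)

  has-rank : HasRank M (a * 4 + suc b)
  has-rank = (basisSet , basisSet-independent , ∣basisSet∣) , λ I indep →
    subst (∣ I ∣ ≤_) (cong (_+ suc b) (m-⨁ AG a)) (independent⇒∣∣≤m (m M) (vec M) indep)
    where
    ∣basisSet∣ : ∣ basisSet ∣ ≡ a * 4 + suc b
    ∣basisSet∣ = trans (∣++∣ (everyBlock basis) ⊤) (cong₂ _+_ (∣⨁ₛ∣ AG a basis) (∣⊤∣≡n (suc b)))

  origins : Fin a → Subset 8
  origins = const ⁅ zero ⁆

  origins-substitute : Substitutes origins
  origins-substitute _ = proj₂ (origin-substitute zero)

  through : ∀ {x} → Element x → (Fin a → Subset 8) → Fin a → Subset 8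
  through (point j p) o = Fun.updateAt o j (const (originSubstitute p))
  through _           o = o

  through-substitutes : ∀ {x o} (ex : Element x) → Substitutes o → Substitutes (through ex o)
  through-substitutes new         substitutes = substitutes
  through-substitutes (unit i)    substitutes = substitutes
  through-substitutes {o = o} (point j p) substitutes i with i ≟ j
  ... | yes refl = subst OriginSubstitute (sym (Funₚ.updateAt-updates j o)) (proj₂ (origin-substitute p))
  ... | no  i≢j  = subst OriginSubstitute (sym (Funₚ.updateAt-minimal i j o i≢j)) (substitutes i)

  ∈-through : ∀ {x} (ex : Element x) o → x ∈ linkSet (through ex o)
  ∈-through new         o = here
  ∈-through (unit i)    o = fr∈linkSet o i
  ∈-through (point j p) o =
    pt∈linkSet⁺ (subst (p ∈_) (sym (Funₚ.updateAt-updates j o)) (proj₁ (origin-substitute p)))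

  SameBlock : ∀ {x y} → Element x → Element y → Set
  SameBlock (point j _) (point j′ _) = j ≡ j′
  SameBlock _           _            = Empty.⊥

  same-block? : ∀ {x y} (ex : Element x) (ey : Element y) → Dec (SameBlock ex ey)
  same-block? (point j _) (point j′ _) = j ≟ j′
  same-block? new         _            = no λ ()
  same-block? (unit _)    _            = no λ ()
  same-block? (point _ _) new          = no λ ()
  same-block? (point _ _) (unit _)     = no λ ()

  through-keeps : ∀ {x y o} (ex : Element x) (ey : Element y) → ¬ SameBlock ex ey →
                  y ∈ linkSet o → y ∈ linkSet (through ex o)
  through-keeps new         _            _ y∈ = y∈
  through-keeps (unit _)    _            _ y∈ = y∈
  through-keeps (point _ _) new          _ _  = here
  through-keeps (point _ _) (unit i)     _ _  = fr∈linkSet _ i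
  through-keeps {o = o} (point j _) (point j′ _) j≢j′ y∈ =
    pt∈linkSet⁺ (subst (_ ∈_) (sym (Funₚ.updateAt-minimal j′ j o (j≢j′ ∘ sym))) (pt∈linkSet⁻ y∈))

  within-block : ∀ {x y} → x ≢ y → (ex : Element x) (ey : Element y) → SameBlock ex ey →
                 ∃[ C ] (Circuit M C × x ∈ C × y ∈ C)
  within-block x≢y (point j p) (point .j p′) refl =
    blockSet j (points q) , block-circuit (plane-circuit q (proj₁ plane) (proj₂ plane)) j ,
    pt∈blockSet⁺ (∈-points⁺ q zero) , pt∈blockSet⁺ (∈-points⁺ q (suc zero))
    where
    q = planeThrough p p′
    plane = plane-through p p′ λ p≡p′ → x≢y (cong (pt j) p≡p′)

  connected : Connected M
  connected x y x≢y with same-block? (element x) (element y)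
  ... | yes same = within-block x≢y (element x) (element y) same
  ... | no apart =
    linkSet (through (element x) (through (element y) origins)) ,
    link-circuit (through-substitutes (element x) (through-substitutes (element y) origins-substitute)) ,
    ∈-through (element x) _ , through-keeps (element x) (element y) apart (∈-through (element y) origins)

-- Counting colours

∈-colorClass : ∀ {n k} (c : Fin n → Fin k) {x j} → c x ≡ j → x ∈ colorClass c j
∈-colorClass c {x} {j} cx≡j =
  lookup⇒[]= x (colorClass c j)
    (trans (lookup∘tabulate _ x) (trans (isYes≗does (c x ≟ j)) (dec-true (c x ≟ j) cx≡j)))

unique-members⇒≤∣∣ : ∀ {n l} {xs : Vec (Fin n) l} {S : Subset n} →
                     Unique xs → All (_∈ S) xs → l ≤ ∣ S ∣
unique-members⇒≤∣∣ []               []            = z≤n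
unique-members⇒≤∣∣ (x∉xs ∷ unique) (x∈S ∷ xs⊆S) =
  ≤-trans (s≤s (unique-members⇒≤∣∣ unique (remaining x∉xs xs⊆S))) (x∈p⇒∣p-x∣<∣p∣ x∈S)
  where
  remaining : ∀ {l x S} {ys : Vec (Fin _) l} → All (x ≢_) ys → All (_∈ S) ys → All (_∈ S - x) ys
  remaining []           []           = []
  remaining (x≢y ∷ x≢ys) (y∈S ∷ ys⊆S) = x∈p∧x≢y⇒x∈p-y y∈S (x≢y ∘ sym) ∷ remaining x≢ys ys⊆S

colours≤length : ∀ {A : Set} {k} (c : A → Fin k) → (∀ j → ∃[ x ] c x ≡ j) →
                 (L : List A) → (∀ x → ListAny.Any (λ y → c y ≡ c x) L) → k ≤ length L
colours≤length c surjective L covers = injective⇒≤ {f = position} position-injective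
  where
  position : _ → Fin (length L)
  position j = ListAny.index (covers (proj₁ (surjective j)))
  colour-at : ∀ j → c (List.lookup L (position j)) ≡ j
  colour-at j = trans (ListAnyₚ.lookup-index (covers (proj₁ (surjective j)))) (proj₂ (surjective j))
  position-injective : ∀ {j j′} → position j ≡ position j′ → j ≡ j′
  position-injective {j} {j′} eq = trans (sym (colour-at j)) (trans (cong (c ∘ List.lookup L) eq) (colour-at j′))

module Colouring (a b : ℕ) where

  open Witness a b

  module _ {k} (c : Fin (n M) → Fin k) (surjective : IsColoring M c) (rainbow-free : RainbowCircuitFree M c)
           (small : ∀ j → ∣ colorClass c j ∣ ≤ 3) where

    colour : Fin a → Fin 8 → Fin k
    colour j = c ∘ pt j

    planes-repeat : ∀ j q → Plane q → Repeated (colour j) q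
    planes-repeat j q plane with unique-or-repeated q
    ... | inj₂ (i , i′ , i≢i′ , eq) = i , i′ , i≢i′ , cong (colour j) eq
    ... | inj₁ distinct with rainbow-free _ (block-circuit (plane-circuit q distinct plane) j)
    ...   | x , y , x≢y , x∈ , y∈ , cx≡cy
      with ∈blockSet⁻ {points q} {j} x∈ | ∈blockSet⁻ {points q} {j} y∈
    ...     | p , p∈ , refl | p′ , p′∈ , refl with ∈-points⁻ q p∈ | ∈-points⁻ q p′∈
    ...       | i , refl | i′ , refl = i , i′ , (λ { refl → x≢y refl }) , cx≡cy

    no-monochromatic-four : ∀ j {p₀ p₁ p₂ p₃} → Unique (p₀ ∷ p₁ ∷ p₂ ∷ p₃ ∷ []) →
      colour j p₁ ≡ colour j p₀ → colour j p₂ ≡ colour j p₀ → colour j p₃ ≢ colour j p₀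
    no-monochromatic-four j distinct c₁ c₂ c₃ = four≰three (≤-trans four-members (small _))
      where
      four-members : 4 ≤ ∣ colorClass c (colour j _) ∣
      four-members = unique-members⇒≤∣∣ (Uniqueₚ.map⁺ (pt-injective j) distinct)
        (∈-colorClass c refl ∷ ∈-colorClass c c₁ ∷ ∈-colorClass c c₂ ∷ ∈-colorClass c c₃ ∷ [])
      four≰three : ¬ 4 ≤ 3
      four≰three (s≤s (s≤s (s≤s ())))

    three-colours : ∀ j → ∃[ u ] ∃[ v ] ∀ p → colour j p ∈ᵥ colour j zero ∷ colour j u ∷ colour j v ∷ []
    three-colours j = at-most-three-colours (colour j) zero
      (no-rainbow-quadruple (colour j) (planes-repeat j) (no-monochromatic-four j))

    second third : Fin a → Fin 8
    second j = proj₁ (three-colours j)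
    third  j = proj₁ (proj₂ (three-colours j))

    originList : List (Fin (n M))
    originList = zero List.∷ List.tabulate (λ j → pt j zero) List.++ List.tabulate fr

    otherColours : List (Fin (n M))
    otherColours = List.tabulate (λ j → pt j (second j)) List.++ List.tabulate (λ j → pt j (third j))

    ∈originList : ∀ {x} → x ∈ linkSet origins → x Listₘ.∈ originList
    ∈originList {x} x∈ with element x
    ... | new    = ListAny.here refl
    ... | unit i = ListAny.there (Listₚ.∈-++⁺ʳ _ (Listₚ.∈-tabulate⁺ {f = fr} i))
    ... | point j p with x∈⁅y⁆⇒x≡y zero (pt∈linkSet⁻ {origins} {j} x∈)
    ...   | refl = ListAny.there (Listₚ.∈-++⁺ˡ (Listₚ.∈-tabulate⁺ j))

    length-originList : length originList ≡ suc (a + suc b)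
    length-originList = cong suc (trans (length-++ (List.tabulate (λ j → pt j zero)))
      (cong₂ _+_ (length-tabulate (λ j → pt j zero)) (length-tabulate fr)))

    length-otherColours : length otherColours ≡ a + a
    length-otherColours = trans (length-++ (List.tabulate (λ j → pt j (second j))))
      (cong₂ _+_ (length-tabulate (λ j → pt j (second j))) (length-tabulate (λ j → pt j (third j))))

    -- x₀ and y₀ are the two equally coloured elements of the circuit through the new element.
    module _ {x₀ y₀} (x₀≢y₀ : x₀ ≢ y₀) (x₀∈ : x₀ ∈ linkSet origins) (y₀∈ : y₀ ∈ linkSet origins)
             (same : c x₀ ≡ c y₀) where

      rest : List (Fin (n M))
      rest = filter (λ x → ¬? (x ≟ y₀)) originList

      length-rest : length rest ≤ a + suc b
      length-rest = ≤-pred (subst (length rest <_) length-originList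
        (filter-notAll (λ x → ¬? (x ≟ y₀)) originList
          (ListAny.map (λ { refl x≢x → x≢x refl }) (∈originList y₀∈))))

      in-rest : ∀ {x} → x ∈ linkSet origins → ListAny.Any (λ y → c y ≡ c x) (rest List.++ otherColours)
      in-rest {x} x∈ = ListAnyₚ.++⁺ˡ (kept (x ≟ y₀))
        where
        kept : Dec (x ≡ y₀) → ListAny.Any (λ y → c y ≡ c x) rest
        kept (yes refl) =
          ListAny.map (λ { refl → same }) (Listₚ.∈-filter⁺ (λ x → ¬? (x ≟ y₀)) (∈originList x₀∈) x₀≢y₀)
        kept (no x≢y₀)  =
          ListAny.map (λ { refl → refl }) (Listₚ.∈-filter⁺ (λ x → ¬? (x ≟ y₀)) (∈originList x∈) x≢y₀)

      colour-of-point : ∀ j p → colour j p ∈ᵥ colour j zero ∷ colour j (second j) ∷ colour j (third j) ∷ [] →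
                        ListAny.Any (λ y → c y ≡ colour j p) (rest List.++ otherColours)
      colour-of-point j p (Any.here eq) =
        ListAny.map (λ e → trans e (sym eq)) (in-rest (pt∈linkSet⁺ {origins} {j} (x∈⁅x⁆ zero)))
      colour-of-point j p (Any.there (Any.here eq)) =
        ListAnyₚ.++⁺ʳ rest (ListAnyₚ.++⁺ˡ (ListAny.map (λ { refl → sym eq }) (Listₚ.∈-tabulate⁺ j)))
      colour-of-point j p (Any.there (Any.there (Any.here eq))) =
        ListAnyₚ.++⁺ʳ rest (ListAnyₚ.++⁺ʳ _ (ListAny.map (λ { refl → sym eq }) (Listₚ.∈-tabulate⁺ j)))

      covers : ∀ {x} → Element x → ListAny.Any (λ y → c y ≡ c x) (rest List.++ otherColours)
      covers new         = in-rest here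
      covers (unit i)    = in-rest (fr∈linkSet origins i)
      covers (point j p) = colour-of-point j p (proj₂ (proj₂ (three-colours j)) p)

      bound-with-repeat : k ≤ a + suc b + (a + a)
      bound-with-repeat = begin
        k                                   ≤⟨ colours≤length c surjective _ (covers ∘ element) ⟩
        length (rest List.++ otherColours)  ≡⟨ length-++ rest ⟩
        length rest + length otherColours   ≤⟨ +-mono-≤ length-rest (≤-reflexive length-otherColours) ⟩
        a + suc b + (a + a)                 ∎
        where open ≤-Reasoning

    colour-bound : k ≤ a + suc b + (a + a)
    colour-bound with rainbow-free (linkSet origins) (link-circuit origins-substitute)
    ... | _ , _ , x₀≢y₀ , x₀∈ , y₀∈ , same = bound-with-repeat x₀≢y₀ x₀∈ y₀∈ same

-- Arithmetic of ⌈6r/7⌉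

rank-decomposition : ∀ r → 1 ≤ r → ∃[ a ] ∃[ b ] (r ≡ a * 4 + suc b × r ≤ 6 + a * 7)
rank-decomposition r r≥1 = r / 7 , r ∸ suc (r / 7 * 4) , r≡ , r≤
  where
  4a<r : ∀ a → a * 7 ≤ r → suc (a * 4) ≤ r
  4a<r zero    _    = r≥1
  4a<r (suc a) 7a≤r = ≤-trans (s≤s (+-mono-≤ 4≤ (*-monoʳ-≤ a 4≤))) 7a≤r
    where
    4≤ : ∀ {k} → 4 ≤ 4 + k
    4≤ = s≤s (s≤s (s≤s (s≤s z≤n)))
  r≡ : r ≡ r / 7 * 4 + suc (r ∸ suc (r / 7 * 4))
  r≡ = sym (trans (+-suc (r / 7 * 4) _) (m+[n∸m]≡n (4a<r (r / 7) (m/n*n≤m r 7))))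
  r≤ : r ≤ 6 + r / 7 * 7
  r≤ = ≤-trans (≤-reflexive (m≡m%n+[m/n]*n r 7)) (+-mono-≤ (≤-pred (m%n<n r 7)) ≤-refl)

seven-times : ∀ a s → (a + s + (a + a)) * 7 + a * 7 ≡ 6 * (a * 4 + s) + (a * 4 + s)
seven-times = solve-∀

regroup : ∀ r a → 6 * r + (6 + a * 7) ≡ 6 * r + 6 + a * 7
regroup = solve-∀

colour-count≤ceil : ∀ a s → a * 4 + s ≤ 6 + a * 7 → a + s + (a + a) ≤ ceil6r/7 (a * 4 + s)
colour-count≤ceil a s r≤ = ≤-trans (≤-reflexive (sym (m*n/n≡m X 7))) (/-monoˡ-≤ 7 X*7≤)
  where
  X = a + s + (a + a)
  r = a * 4 + s
  X*7≤ : X * 7 ≤ 6 * r + 6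
  X*7≤ = +-cancelʳ-≤ (a * 7) (X * 7) (6 * r + 6) (begin
    X * 7 + a * 7        ≡⟨ seven-times a s ⟩
    6 * r + r            ≤⟨ +-monoʳ-≤ (6 * r) r≤ ⟩
    6 * r + (6 + a * 7)  ≡⟨ regroup r a ⟩
    6 * r + 6 + a * 7    ∎)
    where open ≤-Reasoning

corollary8 : ∀ (r : ℕ) → 1 ≤ r →
    ∃[ M ] (TwoCoverable M × Connected M × HasRank M r ×
      (∀ (k : ℕ) (c : Fin (n M) → Fin k) → IsColoring M c → RainbowCircuitFree M c →
        (∀ (j : Fin k) → ∣ colorClass c j ∣ ≤ 3) → k ≤ ceil6r/7 r))
corollary8 r r≥1 with rank-decomposition r r≥1
... | a , b , refl , r≤ =
  M , two-coverable , connected , has-rank ,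
  λ k c surjective rainbow-free small →
    ≤-trans (colour-bound c surjective rainbow-free small) (colour-count≤ceil a (suc b) r≤)
  where
  open Witness a b
  open Colouring a b
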